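{- For all $n\ge1$, $R_{0,2n}=R_{n,2n}=(n!)^2$; that is, the number of permutations $\sigma\in\mathcal{S}_{2n}$ with $\overleftarrow{des}_E(\sigma)=0$ and the number with $\overleftarrow{des}_E(\sigma)=n$ both equal $(n!)^2$.
   Context: $\mathcal{S}_m$ denotes the set of permutations $\sigma=\sigma_1\cdots\sigma_m$ of $\{1,\dots,m\}$. $\overleftarrow{des}_E(\sigma)$ is the number of indices $i\in\{1,\dots,m-1\}$ with $\sigma_i>\sigma_{i+1}$ and $\sigma_i$ even. $R_{k,m}$ denotes the number of $\sigma\in\mathcal{S}_m$ with $\overleftarrow{des}_E(\sigma)=k$. -}

module Defs where

open import Data.Nat using (ℕ; zero; suc; _<ᵇ_; _≡ᵇ_)
open import Data.Nat.Properties using ()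
open import Data.Bool using (Bool; true; false; _∧_; not; if_then_else_)
open import Data.List using (List; []; _∷_; map; concatMap; filter; length; upTo; any; all; applyUpTo)
open import Relation.Nullary.Decidable using ()
open import Data.Bool.Properties using ()
open import Relation.Binary.PropositionalEquality using (_≡_)
open import Data.Nat using (_≟_)

words : ℕ → ℕ → List (List ℕ)
words m zero = [] ∷ []
words m (suc l) = concatMap (λ a → map (a ∷_) (words m l)) (applyUpTo suc m)

elemᵇ : ℕ → List ℕ → Bool
elemᵇ x [] = false
elemᵇ x (y ∷ ys) = if x ≡ᵇ y then true else elemᵇ x ys

distinct : List ℕ → Bool
distinct [] = true
distinct (x ∷ xs) = not (elemᵇ x xs) ∧ distinct xs

-- S_m : permutations σ = σ₁⋯σₘ of {1,…,m} in one-line notation,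
-- i.e. words of length m over {1..m} with distinct letters.
perms : ℕ → List (List ℕ)
perms m = filter (λ w → Data.Bool._≟_ (distinct w) true) (words m m)

evenᵇ : ℕ → Bool
evenᵇ zero = true
evenᵇ (suc zero) = false
evenᵇ (suc (suc n)) = evenᵇ n

desE : List ℕ → ℕ
desE [] = 0
desE (x ∷ []) = 0
desE (x ∷ y ∷ ys) = (if (y <ᵇ x) ∧ evenᵇ x then 1 else 0) Data.Nat.+ desE (y ∷ ys)

R : ℕ → ℕ → ℕ
R k m = length (filter (λ σ → desE σ ≟ k) (perms m))

module Submission where

open import Defs
import Algebra.Properties.CommutativeSemigroup as CommSemigroup
open import Data.Bool using (Bool; true; false; _∧_; not; if_then_else_; T)
import Data.Bool as Bool
open import Data.Bool.Properties using (∧-identityʳ; ∧-zeroʳ; not-injective; T-≡)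
open import Data.Empty using (⊥-elim)
open import Data.List using (List; []; _∷_; [_]; _++_; map; concatMap; length; filter; applyUpTo; applyDownFrom)
open import Data.List.Properties
  using (length-++; length-map; length-applyUpTo; ∷-injectiveˡ; ∷-injectiveʳ; applyUpTo-∷ʳ)
open import Data.List.Membership.Propositional using (_∈_; _∉_; find; lose)
open import Data.List.Membership.Propositional.Properties
  using (∈-map⁺; ∈-map⁻; ∈-++⁺ʳ; ∈-concatMap⁺; ∈-concatMap⁻; ∈-applyDownFrom⁻; ∈-filter⁺; ∈-filter⁻)
open import Data.List.Membership.Propositional.Properties.WithK using (unique∧set⇒bag)
open import Data.List.Relation.Binary.BagAndSetEquality using (∼bag⇒↭)
open import Data.List.Relation.Binary.Permutation.Propositional
  using (_↭_; ↭-refl; ↭-prep; ↭-swap; ↭-trans; ↭-sym; ↭-reflexive; ↭⇒↭ₛ)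
open import Data.List.Relation.Binary.Permutation.Propositional.Properties
  using (↭-length; ∈-resp-↭; drop-∷; ↭-empty-inv; map⁺; ∷↭∷ʳ)
import Data.List.Relation.Binary.Permutation.Setoid.Properties as Permutationₛ
open import Data.List.Relation.Binary.Subset.Propositional using (_⊆_)
open import Data.List.Relation.Unary.All as All using (All; []; _∷_)
open import Data.List.Relation.Unary.AllPairs using ([]; _∷_)
open import Data.List.Relation.Unary.Any using (here; there)
open import Data.List.Relation.Unary.Unique.Propositional using (Unique)
import Data.List.Relation.Unary.Unique.Propositional.Properties as Unique
open import Data.Nat using (ℕ; zero; suc; s≤s; _+_; _*_; _∸_; _≤_; _<_; _<ᵇ_; _≡ᵇ_; _≟_; _!)
open import Data.Nat.ListAction using (sum)
open import Data.Nat.ListAction.Properties using (sum-↭)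
open import Data.Nat.Properties
  using ( ≡ᵇ⇒≡; ≡⇒≡ᵇ; <ᵇ⇒<; <⇒<ᵇ; ≤-refl; <⇒≤; ≤⇒≯; <-irrefl; m≤n⇒m≤1+n; suc-injective; +-suc; +-identityʳ; +-assoc
        ; +-cancelˡ-≡; *-suc; *-zeroʳ; *-assoc; m+n≡0⇒m≡0; m+n≡0⇒n≡0; m+n∸n≡m
        ; +-commutativeSemigroup; *-commutativeSemigroup)
open import Data.Product using (_×_; _,_; proj₁)
open import Data.Unit using (⊤; tt)
open import Function using (_∘_)
open import Function.Bundles using (_⇔_; mk⇔; Equivalence)
open import Relation.Binary.PropositionalEquality
  using (_≡_; _≢_; refl; sym; trans; cong; cong₂; subst; setoid; module ≡-Reasoning)
open import Relation.Nullary using (Dec; yes; no; ¬_; contradiction)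

-- Both counts are obtained by building permutations one letter at a time, inserting the new letter
-- into every admissible position of each admissible arrangement of the letters placed so far.
-- For des_E = 0 the letters are inserted in decreasing order: the new, smallest letter v may only
-- stand first or right after an odd letter (after an even one it creates an even descent), so it
-- has 1 + #{odd letters > v} positions. For des_E = n every even letter must be a descent top; the
-- letters are inserted in increasing order, and the new, largest letter v may only stand first or
-- after an odd letter, and not last if v is even. Admissible words end in an odd letter, so v has
-- #{odd letters ≤ v} positions. In both cases the position counts over v = 1, …, 2n are, up to
-- order, 1, 1, 2, 2, …, n, n, whence (n!)². Deleting the new letter inverts the insertion, so every
-- admissible permutation arises exactly once.

fromBool : Bool → ℕ
fromBool b = if b then 1 else 0

fromBool≡0⇒≡false : ∀ {b} → fromBool b ≡ 0 → b ≡ false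
fromBool≡0⇒≡false {false} _ = refl

fromBool-not : ∀ b → fromBool b + fromBool (not b) ≡ 1
fromBool-not true = refl
fromBool-not false = refl

suc∸fromBool : ∀ b c → suc c ∸ fromBool b ≡ fromBool (not b) + c
suc∸fromBool true c = refl
suc∸fromBool false c = refl

fromBool-∧-split : ∀ d e → fromBool (d ∧ e) + fromBool (e ∧ not d) ≡ fromBool e
fromBool-∧-split true true = refl
fromBool-∧-split true false = refl
fromBool-∧-split false true = refl
fromBool-∧-split false false = refl

<⇒<ᵇ≡true : ∀ {m n} → m < n → (m <ᵇ n) ≡ true
<⇒<ᵇ≡true m<n = Equivalence.to T-≡ (<⇒<ᵇ m<n)

≤⇒<ᵇ≡false : ∀ {m n} → n ≤ m → (m <ᵇ n) ≡ false
≤⇒<ᵇ≡false {m} {n} n≤m with m <ᵇ n in eq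
... | false = refl
... | true = contradiction (<ᵇ⇒< m n (subst T (sym eq) tt)) (≤⇒≯ n≤m)

square-interchange : ∀ s f → s * (s * (f * f)) ≡ (s * f) * (s * f)
square-interchange s f =
  sym (trans (CommSemigroup.interchange *-commutativeSemigroup s f s f) (*-assoc s s (f * f)))

module _ {A : Set} where

  countᵇ : (A → Bool) → List A → ℕ
  countᵇ p xs = sum (map (fromBool ∘ p) xs)

  countᵇ-↭ : ∀ p {xs ys} → xs ↭ ys → countᵇ p xs ≡ countᵇ p ys
  countᵇ-↭ p = sum-↭ ∘ map⁺ (fromBool ∘ p)

  countᵇ-cong : ∀ {p q} {xs : List A} → (∀ {x} → x ∈ xs → p x ≡ q x) → countᵇ p xs ≡ countᵇ q xs
  countᵇ-cong {xs = []} _ = refl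
  countᵇ-cong {xs = x ∷ xs} p≗q = cong₂ _+_ (cong fromBool (p≗q (here refl))) (countᵇ-cong (p≗q ∘ there))

  onlyIf : Bool → A → List A
  onlyIf true x = [ x ]
  onlyIf false _ = []

  length-onlyIf : ∀ b x → length (onlyIf b x) ≡ fromBool b
  length-onlyIf true _ = refl
  length-onlyIf false _ = refl

  ∈-onlyIf⁻ : ∀ {b x y} → y ∈ onlyIf b x → y ≡ x
  ∈-onlyIf⁻ {true} (here y≡x) = y≡x

  onlyIf-unique : ∀ b x → Unique (onlyIf b x)
  onlyIf-unique true _ = [] ∷ []
  onlyIf-unique false _ = []

  unique∧set⇒↭ : ∀ {xs ys : List A} → Unique xs → Unique ys → xs ⊆ ys → ys ⊆ xs → xs ↭ ys
  unique∧set⇒↭ uxs uys xs⊆ys ys⊆xs = ∼bag⇒↭ (unique∧set⇒bag uxs uys (mk⇔ xs⊆ys ys⊆xs))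

  applyDownFrom↭applyUpTo : ∀ (f : ℕ → A) n → applyDownFrom f n ↭ applyUpTo f n
  applyDownFrom↭applyUpTo f zero = ↭-refl
  applyDownFrom↭applyUpTo f (suc n) =
    ↭-trans (↭-prep (f n) (applyDownFrom↭applyUpTo f n))
      (↭-trans (∷↭∷ʳ (f n) (applyUpTo f n)) (↭-reflexive (applyUpTo-∷ʳ f n)))

module _ {A B : Set} (f : A → List B) where

  Unique-concatMap : ∀ {xs} → Unique xs → (∀ {x} → x ∈ xs → Unique (f x)) →
    (∀ {x x′ y} → x ∈ xs → x′ ∈ xs → y ∈ f x → y ∈ f x′ → x ≡ x′) →
    Unique (concatMap f xs)
  Unique-concatMap {[]} _ _ _ = []
  Unique-concatMap {x ∷ xs} (x∉xs ∷ uxs) uf disjoint =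
    Unique.++⁺ (uf (here refl)) (Unique-concatMap uxs (uf ∘ there) (λ p q → disjoint (there p) (there q)))
               apart
    where
    apart : ∀ {y} → ¬ (y ∈ f x × y ∈ concatMap f xs)
    apart (y∈fx , y∈rest) with find (∈-concatMap⁻ f {xs = xs} y∈rest)
    ... | x′ , x′∈xs , y∈fx′ =
      All.lookup x∉xs x′∈xs (disjoint (here refl) (there x′∈xs) y∈fx y∈fx′)

  length-concatMap-const : ∀ {c xs} → (∀ {x} → x ∈ xs → length (f x) ≡ c) →
    length (concatMap f xs) ≡ c * length xs
  length-concatMap-const {c} {[]} _ = sym (*-zeroʳ c)
  length-concatMap-const {c} {x ∷ xs} len = begin
    length (f x ++ concatMap f xs)
      ≡⟨ length-++ (f x) ⟩
    length (f x) + length (concatMap f xs)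
      ≡⟨ cong₂ _+_ (len (here refl)) (length-concatMap-const (len ∘ there)) ⟩
    c + c * length xs
      ≡⟨ sym (*-suc c (length xs)) ⟩
    c * suc (length xs) ∎
    where open ≡-Reasoning

delete : ℕ → List ℕ → List ℕ
delete v [] = []
delete v (a ∷ xs) with a ≟ v
... | yes _ = xs
... | no _ = a ∷ delete v xs

delete-head : ∀ v xs → delete v (v ∷ xs) ≡ xs
delete-head v xs with v ≟ v
... | yes _ = refl
... | no v≢v = contradiction refl v≢v

delete-∷ : ∀ {a v} xs → a ≢ v → delete v (a ∷ xs) ≡ a ∷ delete v xs
delete-∷ {a} {v} xs a≢v with a ≟ v
... | yes a≡v = contradiction a≡v a≢v
... | no _ = refl

↭-delete : ∀ {v xs} → v ∈ xs → xs ↭ v ∷ delete v xs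
↭-delete {v} {a ∷ xs} v∈ with a ≟ v | v∈
... | yes refl | _ = ↭-refl
... | no a≢v | here v≡a = contradiction (sym v≡a) a≢v
... | no a≢v | there v∈xs = ↭-trans (↭-prep a (↭-delete v∈xs)) (↭-swap a v ↭-refl)

Unique∧⊆∧length⇒↭ : ∀ {xs ys : List ℕ} → Unique xs → xs ⊆ ys → length xs ≡ length ys → xs ↭ ys
Unique∧⊆∧length⇒↭ {[]} {[]} _ _ _ = ↭-refl
Unique∧⊆∧length⇒↭ {x ∷ xs} {ys} (x∉xs ∷ uxs) xs⊆ys len =
  ↭-trans (↭-prep x (Unique∧⊆∧length⇒↭ uxs xs⊆rest (suc-injective (trans len (↭-length ys↭)))))
          (↭-sym ys↭)
  where
  ys↭ : ys ↭ x ∷ delete x ys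
  ys↭ = ↭-delete (xs⊆ys (here refl))
  xs⊆rest : xs ⊆ delete x ys
  xs⊆rest z∈xs with ∈-resp-↭ ys↭ (xs⊆ys (there z∈xs))
  ... | here z≡x = contradiction (sym z≡x) (All.lookup x∉xs z∈xs)
  ... | there z∈rest = z∈rest

interval : ℕ → ℕ → List ℕ
interval a zero = []
interval a (suc k) = a ∷ interval (suc a) k

applyUpTo≡interval : ∀ (f : ℕ → ℕ) a k → (∀ i → f i ≡ a + i) → applyUpTo f k ≡ interval a k
applyUpTo≡interval f a zero _ = refl
applyUpTo≡interval f a (suc k) f≗a+ =
  cong₂ _∷_ (trans (f≗a+ 0) (+-identityʳ a))
            (applyUpTo≡interval (f ∘ suc) (suc a) k (λ i → trans (f≗a+ (suc i)) (+-suc a i)))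

∈-interval⁻ : ∀ {z} a k → z ∈ interval a k → a ≤ z
∈-interval⁻ a (suc k) (here refl) = ≤-refl
∈-interval⁻ a (suc k) (there z∈) = <⇒≤ (∈-interval⁻ (suc a) k z∈)

∈-downFrom⁻ : ∀ {z} k → z ∈ applyDownFrom suc k → z ≤ k
∈-downFrom⁻ k z∈ with ∈-applyDownFrom⁻ suc z∈
... | _ , i<k , refl = i<k

odd : ℕ → Bool
odd n = not (evenᵇ n)

evenᵇ-suc : ∀ n → evenᵇ (suc n) ≡ not (evenᵇ n)
evenᵇ-suc zero = refl
evenᵇ-suc (suc zero) = refl
evenᵇ-suc (suc (suc n)) = evenᵇ-suc n

odd-alternates : ∀ a → odd (suc a) ≡ not (odd a)
odd-alternates a = cong not (evenᵇ-suc a)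

evenᵇ-double : ∀ m → evenᵇ (m + m) ≡ true
evenᵇ-double zero = refl
evenᵇ-double (suc m) rewrite +-suc m m = evenᵇ-double m

countᵇ-interval-double : ∀ p → (∀ a → p (suc a) ≡ not (p a)) → ∀ a m →
  countᵇ p (interval a (m + m)) ≡ m
countᵇ-interval-double p alternates a zero = refl
countᵇ-interval-double p alternates a (suc m) rewrite +-suc m m = begin
  fromBool (p a) + (fromBool (p (suc a)) + countᵇ p (interval (suc (suc a)) (m + m)))
    ≡⟨ sym (+-assoc (fromBool (p a)) _ _) ⟩
  (fromBool (p a) + fromBool (p (suc a))) + countᵇ p (interval (suc (suc a)) (m + m))
    ≡⟨ cong₂ _+_ (trans (cong (λ b → fromBool (p a) + fromBool b) (alternates a)) (fromBool-not (p a)))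
                 (countᵇ-interval-double p alternates (suc (suc a)) m) ⟩
  suc m ∎
  where open ≡-Reasoning

countᵇ-↭oneTo-double : ∀ p → (∀ a → p (suc a) ≡ not (p a)) → ∀ {xs} m →
  xs ↭ applyUpTo suc (m + m) → countᵇ p xs ≡ m
countᵇ-↭oneTo-double p alternates {xs} m xs↭ = begin
  countᵇ p xs                       ≡⟨ countᵇ-↭ p xs↭ ⟩
  countᵇ p (applyUpTo suc (m + m))  ≡⟨ cong (countᵇ p) (applyUpTo≡interval suc 1 (m + m) (λ _ → refl)) ⟩
  countᵇ p (interval 1 (m + m))     ≡⟨ countᵇ-interval-double p alternates 1 m ⟩
  m                                 ∎
  where open ≡-Reasoning

elemᵇ⇒∈ : ∀ {x xs} → elemᵇ x xs ≡ true → x ∈ xs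
elemᵇ⇒∈ {x} {y ∷ ys} e with x ≡ᵇ y in x≡ᵇy
... | true = here (≡ᵇ⇒≡ x y (subst T (sym x≡ᵇy) tt))
... | false = there (elemᵇ⇒∈ e)

elemᵇ≡false⇒∉ : ∀ {x xs} → elemᵇ x xs ≡ false → x ∉ xs
elemᵇ≡false⇒∉ {x} {y ∷ ys} e x∈ with x ≡ᵇ y in x≡ᵇy | e | x∈
... | false | _ | here x≡y = subst T x≡ᵇy (≡⇒≡ᵇ x y x≡y)
... | false | e′ | there x∈ys = elemᵇ≡false⇒∉ e′ x∈ys

distinct⇒Unique : ∀ {xs} → distinct xs ≡ true → Unique xs
distinct⇒Unique {[]} _ = []
distinct⇒Unique {x ∷ xs} d with elemᵇ x xs in x∉xs
... | false = All.tabulate (λ { y∈xs refl → elemᵇ≡false⇒∉ x∉xs y∈xs }) ∷ distinct⇒Unique d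

Unique⇒distinct : ∀ {xs} → Unique xs → distinct xs ≡ true
Unique⇒distinct {[]} _ = refl
Unique⇒distinct {x ∷ xs} (x∉xs ∷ uxs) with elemᵇ x xs in x∈xs
... | false = Unique⇒distinct uxs
... | true = ⊥-elim (All.lookup x∉xs (elemᵇ⇒∈ x∈xs) refl)

oneTo-unique : ∀ m → Unique (applyUpTo suc m)
oneTo-unique m = Unique.applyUpTo⁺₁ suc m (λ { i<j _ refl → <-irrefl refl i<j })

words-unique : ∀ m l → Unique (words m l)
words-unique m zero = [] ∷ []
words-unique m (suc l) =
  Unique-concatMap (λ a → map (a ∷_) (words m l)) (oneTo-unique m)
    (λ _ → Unique.map⁺ ∷-injectiveʳ (words-unique m l)) sameHead
  where
  sameHead : ∀ {a a′ w} → a ∈ applyUpTo suc m → a′ ∈ applyUpTo suc m →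
    w ∈ map (a ∷_) (words m l) → w ∈ map (a′ ∷_) (words m l) → a ≡ a′
  sameHead _ _ w∈ w∈′ with ∈-map⁻ (_ ∷_) w∈ | ∈-map⁻ (_ ∷_) w∈′
  ... | _ , _ , refl | _ , _ , eq = ∷-injectiveˡ eq

∈-words⁻ : ∀ m l {w} → w ∈ words m l → length w ≡ l × All (_∈ applyUpTo suc m) w
∈-words⁻ m zero (here refl) = refl , []
∈-words⁻ m (suc l) w∈
  with find (∈-concatMap⁻ (λ a → map (a ∷_) (words m l)) {xs = applyUpTo suc m} w∈)
... | a , a∈ , w∈′ with ∈-map⁻ (a ∷_) w∈′
...   | w′ , w′∈ , refl with ∈-words⁻ m l w′∈
...     | len , letters = cong suc len , a∈ ∷ letters

∈-words⁺ : ∀ m {w} → All (_∈ applyUpTo suc m) w → w ∈ words m (length w)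
∈-words⁺ m [] = here refl
∈-words⁺ m {a ∷ w} (a∈ ∷ letters) =
  ∈-concatMap⁺ (λ b → map (b ∷_) (words m (length w))) (lose a∈ (∈-map⁺ (a ∷_) (∈-words⁺ m letters)))

perms-unique : ∀ m → Unique (perms m)
perms-unique m = Unique.filter⁺ (λ w → Bool._≟_ (distinct w) true) (words-unique m m)

∈-perms⁻ : ∀ m {σ} → σ ∈ perms m → σ ↭ applyUpTo suc m
∈-perms⁻ m σ∈ with ∈-filter⁻ (λ w → Bool._≟_ (distinct w) true) {xs = words m m} σ∈
... | σ∈words , d with ∈-words⁻ m m σ∈words
...   | len , letters =
  Unique∧⊆∧length⇒↭ (distinct⇒Unique d) (All.lookup letters) (trans len (sym (length-applyUpTo suc m)))

∈-perms⁺ : ∀ m {σ} → σ ↭ applyUpTo suc m → σ ∈ perms m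
∈-perms⁺ m {σ} σ↭ = ∈-filter⁺ (λ w → Bool._≟_ (distinct w) true)
  (subst (λ l → σ ∈ words m l) (trans (↭-length σ↭) (length-applyUpTo suc m))
         (∈-words⁺ m (All.tabulate (∈-resp-↭ σ↭))))
  (Unique⇒distinct (Permutationₛ.Unique-resp-↭ (setoid ℕ) (↭⇒↭ₛ (↭-sym σ↭)) (oneTo-unique m)))

R≡length : ∀ k m {ps} → Unique ps → (∀ {σ} → σ ∈ ps → σ ↭ applyUpTo suc m × desE σ ≡ k) →
  (∀ {σ} → σ ↭ applyUpTo suc m → desE σ ≡ k → σ ∈ ps) → R k m ≡ length ps
R≡length k m {ps} ups sound complete =
  ↭-length (unique∧set⇒↭ (Unique.filter⁺ hasDescents (perms-unique m)) ups toPs fromPs)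
  where
  hasDescents : ∀ σ → Dec (desE σ ≡ k)
  hasDescents σ = desE σ ≟ k
  toPs : filter hasDescents (perms m) ⊆ ps
  toPs σ∈ with ∈-filter⁻ hasDescents {xs = perms m} σ∈
  ... | σ∈perms , d = complete (∈-perms⁻ m σ∈perms) d
  fromPs : ps ⊆ filter hasDescents (perms m)
  fromPs σ∈ with sound σ∈
  ... | σ↭ , d = ∈-filter⁺ hasDescents (∈-perms⁺ m σ↭) d

-- B x y: x may not be immediately followed by y.  E x: x may not be the last letter.
module Arrangements (B : ℕ → ℕ → Bool) (E : ℕ → Bool) where

  Admissible : List ℕ → Set
  Admissible [] = ⊤
  Admissible (x ∷ []) = E x ≡ false
  Admissible (x ∷ y ∷ ys) = B x y ≡ false × Admissible (y ∷ ys)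

  violations : List ℕ → ℕ
  violations [] = 0
  violations (x ∷ []) = fromBool (E x)
  violations (x ∷ y ∷ ys) = fromBool (B x y) + violations (y ∷ ys)

  Admissible⇔violations≡0 : ∀ xs → Admissible xs ⇔ violations xs ≡ 0
  Admissible⇔violations≡0 xs = mk⇔ (to xs) (from xs)
    where
    to : ∀ xs → Admissible xs → violations xs ≡ 0
    to [] _ = refl
    to (x ∷ []) e = cong fromBool e
    to (x ∷ y ∷ ys) (b , adm) = cong₂ _+_ (cong fromBool b) (to (y ∷ ys) adm)
    from : ∀ xs → violations xs ≡ 0 → Admissible xs
    from [] _ = tt
    from (x ∷ []) v = fromBool≡0⇒≡false v
    from (x ∷ y ∷ ys) v = fromBool≡0⇒≡false (m+n≡0⇒m≡0 _ v) , from (y ∷ ys) (m+n≡0⇒n≡0 _ v)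

  Unrestricted : ℕ → Set
  Unrestricted p = (∀ y → B p y ≡ false) × E p ≡ false

  PrecedesAll : ℕ → List ℕ → Set
  PrecedesAll v w = ∀ {y} → y ∈ w → B v y ≡ false

  Endable : ℕ → List ℕ → Set
  Endable v w = E v ≡ true → ∀ {p} → p ∈ w → E p ≡ false → B p v ≡ false

  Admissible-∷ : ∀ {p} ws → Unrestricted p → Admissible ws → Admissible (p ∷ ws)
  Admissible-∷ [] (_ , e) _ = e
  Admissible-∷ (y ∷ ws) (b , _) adm = b y , adm

  -- The flag says whether the letter preceding w (if any) may be followed by v.
  insertions : Bool → ℕ → List ℕ → List (List ℕ)
  insertions f v [] = onlyIf (f ∧ not (E v)) [ v ]
  insertions f v (b ∷ w) = onlyIf f (v ∷ b ∷ w) ++ map (b ∷_) (insertions (not (B b v)) v w)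

  data Placement (v : ℕ) : Bool → List ℕ → List ℕ → Set where
    atEnd : E v ≡ false → Placement v true [] [ v ]
    front : ∀ {b w} → Placement v true (b ∷ w) (v ∷ b ∷ w)
    after : ∀ {f b w x} → Placement v (not (B b v)) w x → Placement v f (b ∷ w) (b ∷ x)

  ∈-insertions⁻ : ∀ {f v} w {x} → x ∈ insertions f v w → Placement v f w x
  ∈-insertions⁻ {true} {v} [] x∈ with E v in e | x∈
  ... | false | here refl = atEnd e
  ∈-insertions⁻ {true} (b ∷ w) (here refl) = front
  ∈-insertions⁻ {true} (b ∷ w) (there x∈) with ∈-map⁻ (b ∷_) x∈
  ... | _ , x′∈ , refl = after (∈-insertions⁻ w x′∈)
  ∈-insertions⁻ {false} (b ∷ w) x∈ with ∈-map⁻ (b ∷_) x∈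
  ... | _ , x′∈ , refl = after (∈-insertions⁻ w x′∈)

  ∈-insertions⁺ : ∀ {f v w x} → Placement v f w x → x ∈ insertions f v w
  ∈-insertions⁺ (atEnd e) rewrite e = here refl
  ∈-insertions⁺ front = here refl
  ∈-insertions⁺ {f} {v} (after {b = b} {w} p) =
    ∈-++⁺ʳ (onlyIf f (v ∷ b ∷ w)) (∈-map⁺ (b ∷_) (∈-insertions⁺ p))

  placement-↭ : ∀ {f v w x} → Placement v f w x → x ↭ v ∷ w
  placement-↭ (atEnd _) = ↭-refl
  placement-↭ front = ↭-refl
  placement-↭ {v = v} (after {b = b} p) = ↭-trans (↭-prep b (placement-↭ p)) (↭-swap b v ↭-refl)

  delete-placement : ∀ {f v w x} → Placement v f w x → v ∉ w → delete v x ≡ w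
  delete-placement {v = v} (atEnd _) _ = delete-head v []
  delete-placement {v = v} (front {b} {w}) _ = delete-head v (b ∷ w)
  delete-placement (after {b = b} {x = x} p) v∉ =
    trans (delete-∷ x (λ b≡v → v∉ (here (sym b≡v))))
          (cong (b ∷_) (delete-placement p (v∉ ∘ there)))

  admissible-after : ∀ {f a v w x} → PrecedesAll v w → (f ≡ true → B a v ≡ false) →
    Placement v f w x → Admissible (a ∷ w) → Admissible (a ∷ x)
  admissible-after _ a≺v (atEnd e) _ = a≺v refl , e
  admissible-after v≺ a≺v front (_ , adm) = a≺v refl , v≺ (here refl) , adm
  admissible-after v≺ _ (after p) (a≺b , adm) = a≺b , admissible-after (v≺ ∘ there) not-injective p adm

  admissible-placement : ∀ {v w x} → PrecedesAll v w → Placement v true w x → Admissible w → Admissible x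
  admissible-placement _ (atEnd e) _ = e
  admissible-placement v≺ front adm = v≺ (here refl) , adm
  admissible-placement v≺ (after p) adm = admissible-after (v≺ ∘ there) not-injective p adm

  insertions-unique : ∀ f v w → v ∉ w → Unique (insertions f v w)
  insertions-unique f v [] _ = onlyIf-unique _ _
  insertions-unique f v (b ∷ w) v∉ =
    Unique.++⁺ (onlyIf-unique f _) (Unique.map⁺ ∷-injectiveʳ (insertions-unique _ v w (v∉ ∘ there)))
               apart
    where
    apart : ∀ {x} → ¬ (x ∈ onlyIf f (v ∷ b ∷ w) × x ∈ map (b ∷_) (insertions (not (B b v)) v w))
    apart (x∈front , x∈rest) with ∈-onlyIf⁻ {b = f} x∈front | ∈-map⁻ (b ∷_) x∈rest
    ... | refl | _ , _ , eq = v∉ (here (∷-injectiveˡ eq))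

  placement : ∀ {f v} x → v ∈ x → Admissible x → (∀ {r} → x ≡ v ∷ r → f ≡ true) →
    Placement v f (delete v x) x
  placement {f} {v} (a ∷ r) v∈ adm firstOk with a ≟ v
  placement {f} (a ∷ r) v∈ adm firstOk | yes refl with firstOk refl
  placement (a ∷ []) v∈ adm firstOk | yes refl | refl = atEnd adm
  placement (a ∷ b ∷ r) v∈ adm firstOk | yes refl | refl = front
  placement (a ∷ r) (here v≡a) adm firstOk | no a≢v = contradiction (sym v≡a) a≢v
  placement {v = v} (a ∷ b ∷ r) (there v∈) (a≺b , adm) firstOk | no a≢v =
    after (placement (b ∷ r) v∈ adm a≺v)
    where
    a≺v : ∀ {r′} → b ∷ r ≡ v ∷ r′ → not (B a v) ≡ true
    a≺v refl = cong not a≺b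

  delete-admissible : ∀ v x → Admissible x → (∀ {p} → p ∈ x → p ≢ v → B p v ≡ false → Unrestricted p) →
    Admissible (delete v x)
  delete-admissible v [] _ _ = tt
  delete-admissible v (a ∷ []) adm _ with a ≟ v
  ... | yes _ = tt
  ... | no _ = adm
  delete-admissible v (a ∷ b ∷ r) (a≺b , adm) removable
    with a ≟ v | delete-admissible v (b ∷ r) adm (removable ∘ there)
  ... | yes _ | _ = adm
  ... | no a≢v | adm-rest = prepend adm-rest
    where
    prepend : Admissible (delete v (b ∷ r)) → Admissible (a ∷ delete v (b ∷ r))
    prepend adm′ with b ≟ v
    ... | yes b≡v =
      Admissible-∷ r (removable (here refl) a≢v (subst (λ z → B a z ≡ false) b≡v a≺b)) adm′
    ... | no _ = a≺b , adm′

  -- Under these conditions deleting v from an admissible arrangement of v ∷ vs leaves an admissible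
  -- arrangement of vs, and all admissible arrangements of vs offer v the same number of slots.
  record Insertable (v : ℕ) (vs : List ℕ) : Set where
    field
      fresh        : v ∉ vs
      precedes-all : PrecedesAll v vs
      removable    : ∀ {p} → p ∈ vs → B p v ≡ false → Unrestricted p
      endable      : Endable v vs

  InsertionChain : List ℕ → Set
  InsertionChain [] = ⊤
  InsertionChain (v ∷ vs) = Insertable v vs × InsertionChain vs

  arrangements : List ℕ → List (List ℕ)
  arrangements [] = [ [] ]
  arrangements (v ∷ vs) = concatMap (insertions true v) (arrangements vs)

  arrangements-sound : ∀ vs → InsertionChain vs → ∀ {x} → x ∈ arrangements vs → x ↭ vs × Admissible x
  arrangements-sound [] _ (here refl) = ↭-refl , tt
  arrangements-sound (v ∷ vs) (ins , chain) x∈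
    with find (∈-concatMap⁻ (insertions true v) {xs = arrangements vs} x∈)
  ... | w , w∈ , x∈w with arrangements-sound vs chain w∈ | ∈-insertions⁻ w x∈w
  ... | w↭vs , adm | p =
    ↭-trans (placement-↭ p) (↭-prep v w↭vs) ,
    admissible-placement (Insertable.precedes-all ins ∘ ∈-resp-↭ w↭vs) p adm

  arrangements-complete : ∀ vs → InsertionChain vs → ∀ {x} → x ↭ vs → Admissible x → x ∈ arrangements vs
  arrangements-complete [] _ x↭[] _ rewrite ↭-empty-inv x↭[] = here refl
  arrangements-complete (v ∷ vs) (ins , chain) {x} x↭ adm =
    ∈-concatMap⁺ (insertions true v)
      (lose (arrangements-complete vs chain rest↭vs (delete-admissible v x adm removable))
            (∈-insertions⁺ (placement x v∈x adm (λ _ → refl))))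
    where
    v∈x : v ∈ x
    v∈x = ∈-resp-↭ (↭-sym x↭) (here refl)
    rest↭vs : delete v x ↭ vs
    rest↭vs = drop-∷ (↭-trans (↭-sym (↭-delete v∈x)) x↭)
    removable : ∀ {p} → p ∈ x → p ≢ v → B p v ≡ false → Unrestricted p
    removable p∈ p≢v with ∈-resp-↭ x↭ p∈
    ... | here p≡v = contradiction p≡v p≢v
    ... | there p∈vs = Insertable.removable ins p∈vs

  arrangements-unique : ∀ vs → InsertionChain vs → Unique (arrangements vs)
  arrangements-unique [] _ = [] ∷ []
  arrangements-unique (v ∷ vs) (ins , chain) =
    Unique-concatMap (insertions true v) (arrangements-unique vs chain)
      (λ w∈ → insertions-unique true v _ (v∉ w∈)) sameBase
    where
    v∉ : ∀ {w} → w ∈ arrangements vs → v ∉ w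
    v∉ w∈ = Insertable.fresh ins ∘ ∈-resp-↭ (proj₁ (arrangements-sound vs chain w∈))
    sameBase : ∀ {w w′ x} → w ∈ arrangements vs → w′ ∈ arrangements vs →
      x ∈ insertions true v w → x ∈ insertions true v w′ → w ≡ w′
    sameBase w∈ w′∈ x∈ x∈′ =
      trans (sym (delete-placement (∈-insertions⁻ _ x∈) (v∉ w∈)))
            (delete-placement (∈-insertions⁻ _ x∈′) (v∉ w′∈))

  -- The subtraction removes the final position when v may not be last; it never truncates.
  slots : ℕ → List ℕ → ℕ
  slots v w = suc (countᵇ (λ p → not (B p v)) w) ∸ fromBool (E v)

  slots-↭ : ∀ v {w w′} → w ↭ w′ → slots v w ≡ slots v w′
  slots-↭ v w↭w′ = cong (λ c → suc c ∸ fromBool (E v)) (countᵇ-↭ _ w↭w′)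

  lastFlag : Bool → ℕ → List ℕ → Bool
  lastFlag f v [] = f
  lastFlag f v (b ∷ w) = lastFlag (not (B b v)) v w

  length-insertions-flag : ∀ f v w →
    length (insertions f v w) + fromBool (lastFlag f v w ∧ E v) ≡ fromBool f + countᵇ (λ p → not (B p v)) w
  length-insertions-flag false v [] = refl
  length-insertions-flag true v [] with E v
  ... | true = refl
  ... | false = refl
  length-insertions-flag f v (b ∷ w) = begin
    length (onlyIf f (v ∷ b ∷ w) ++ map (b ∷_) rest) + final
      ≡⟨ cong (_+ final) (trans (length-++ (onlyIf f (v ∷ b ∷ w)))
                                (cong₂ _+_ (length-onlyIf f _) (length-map (b ∷_) rest))) ⟩
    fromBool f + length rest + final
      ≡⟨ +-assoc (fromBool f) _ _ ⟩
    fromBool f + (length rest + final)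
      ≡⟨ cong (fromBool f +_) (length-insertions-flag (not (B b v)) v w) ⟩
    fromBool f + countᵇ (λ p → not (B p v)) (b ∷ w) ∎
    where
    open ≡-Reasoning
    rest : List (List ℕ)
    rest = insertions (not (B b v)) v w
    final : ℕ
    final = fromBool (lastFlag (not (B b v)) v w ∧ E v)

  lastFlag-∷ : ∀ f v b w → Admissible (b ∷ w) → (∀ {p} → p ∈ b ∷ w → E p ≡ false → B p v ≡ false) →
    lastFlag f v (b ∷ w) ≡ true
  lastFlag-∷ f v b [] adm endable = cong not (endable (here refl) adm)
  lastFlag-∷ f v b (c ∷ w) (_ , adm) endable = lastFlag-∷ (not (B b v)) v c w adm (endable ∘ there)

  lastFlag∧E : ∀ v w → Admissible w → Endable v w → lastFlag true v w ∧ E v ≡ E v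
  lastFlag∧E v w adm endable with E v
  lastFlag∧E v w adm endable | false = ∧-zeroʳ _
  lastFlag∧E v [] adm endable | true = refl
  lastFlag∧E v (b ∷ w) adm endable | true = trans (∧-identityʳ _) (lastFlag-∷ true v b w adm (endable refl))

  length-insertions : ∀ {v w} → Admissible w → Endable v w → length (insertions true v w) ≡ slots v w
  length-insertions {v} {w} adm endable = begin
    n
      ≡⟨ sym (m+n∸n≡m n (fromBool (E v))) ⟩
    n + fromBool (E v) ∸ fromBool (E v)
      ≡⟨ cong (λ e → n + fromBool e ∸ fromBool (E v)) (sym (lastFlag∧E v w adm endable)) ⟩
    n + fromBool (lastFlag true v w ∧ E v) ∸ fromBool (E v)
      ≡⟨ cong (_∸ fromBool (E v)) (length-insertions-flag true v w) ⟩
    slots v w ∎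
    where
    open ≡-Reasoning
    n : ℕ
    n = length (insertions true v w)

  length-arrangements : ∀ v vs → InsertionChain (v ∷ vs) →
    length (arrangements (v ∷ vs)) ≡ slots v vs * length (arrangements vs)
  length-arrangements v vs (ins , chain) = length-concatMap-const (insertions true v) slotsOf
    where
    slotsOf : ∀ {w} → w ∈ arrangements vs → length (insertions true v w) ≡ slots v vs
    slotsOf w∈ with arrangements-sound vs chain w∈
    ... | w↭vs , adm =
      trans (length-insertions adm (λ e p∈ → Insertable.endable ins e (∈-resp-↭ w↭vs p∈)))
            (slots-↭ v w↭vs)

  R≡length-arrangements : ∀ {k m vs} → InsertionChain vs → vs ↭ applyUpTo suc m →
    (∀ {σ} → σ ↭ applyUpTo suc m → Admissible σ ⇔ desE σ ≡ k) → R k m ≡ length (arrangements vs)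
  R≡length-arrangements {k} {m} {vs} chain vs↭ admissible⇔ =
    R≡length k m (arrangements-unique vs chain) sound complete
    where
    sound : ∀ {σ} → σ ∈ arrangements vs → σ ↭ applyUpTo suc m × desE σ ≡ k
    sound σ∈ with arrangements-sound vs chain σ∈
    ... | σ↭vs , adm = ↭-trans σ↭vs vs↭ , Equivalence.to (admissible⇔ (↭-trans σ↭vs vs↭)) adm
    complete : ∀ {σ} → σ ↭ applyUpTo suc m → desE σ ≡ k → σ ∈ arrangements vs
    complete σ↭ d =
      arrangements-complete vs chain (↭-trans σ↭ (↭-sym vs↭)) (Equivalence.from (admissible⇔ σ↭) d)

module EvenDescentFree where

  B₀ : ℕ → ℕ → Bool
  B₀ x y = (y <ᵇ x) ∧ evenᵇ x

  open Arrangements B₀ (λ _ → false)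

  B₀-odd : ∀ {p} → evenᵇ p ≡ false → ∀ y → B₀ p y ≡ false
  B₀-odd {p} odd-p y = trans (cong ((y <ᵇ p) ∧_) odd-p) (∧-zeroʳ _)

  B₀-above : ∀ {a p} → a < p → B₀ p a ≡ evenᵇ p
  B₀-above {p = p} a<p = cong (_∧ evenᵇ p) (<⇒<ᵇ≡true a<p)

  interval-chain : ∀ a k → InsertionChain (interval a k)
  interval-chain a zero = tt
  interval-chain a (suc k) = insertable , interval-chain (suc a) k
    where
    above : ∀ {z} → z ∈ interval (suc a) k → a < z
    above = ∈-interval⁻ (suc a) k
    insertable : Insertable a (interval (suc a) k)
    insertable = record
      { fresh        = λ a∈ → <-irrefl refl (above a∈)
      ; precedes-all = λ y∈ → cong (_∧ evenᵇ a) (≤⇒<ᵇ≡false (<⇒≤ (above y∈)))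
      ; removable    = λ {p} p∈ p≺a → B₀-odd {p} (trans (sym (B₀-above (above p∈))) p≺a) , refl
      ; endable      = λ ()
      }

  length-arrangements-interval : ∀ a k →
    length (arrangements (interval a (suc k))) ≡
    suc (countᵇ odd (interval (suc a) k)) * length (arrangements (interval (suc a) k))
  length-arrangements-interval a k =
    trans (length-arrangements a (interval (suc a) k) (interval-chain a (suc k)))
      (cong (λ c → suc c * length (arrangements (interval (suc a) k)))
        (countᵇ-cong (λ p∈ → cong not (B₀-above (∈-interval⁻ (suc a) k p∈)))))

  length-arrangements-interval-double : ∀ m a → evenᵇ a ≡ false →
    length (arrangements (interval a (m + m))) ≡ m ! * m !
  length-arrangements-interval-double zero a _ = refl
  length-arrangements-interval-double (suc m) a odd-a rewrite +-suc m m = begin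
    length (arrangements (interval a (suc (suc (m + m)))))
      ≡⟨ length-arrangements-interval a (suc (m + m)) ⟩
    suc (countᵇ odd (interval (suc a) (suc (m + m)))) * length (arrangements (interval (suc a) (suc (m + m))))
      ≡⟨ cong₂ _*_ (cong suc oddCount) (length-arrangements-interval (suc a) (m + m)) ⟩
    suc m * (suc (countᵇ odd (interval (suc (suc a)) (m + m)))
             * length (arrangements (interval (suc (suc a)) (m + m))))
      ≡⟨ cong₂ (λ c l → suc m * (suc c * l)) (countᵇ-interval-double odd odd-alternates (suc (suc a)) m)
                                             (length-arrangements-interval-double m (suc (suc a)) odd-a) ⟩
    suc m * (suc m * (m ! * m !))
      ≡⟨ square-interchange (suc m) (m !) ⟩
    suc m ! * suc m ! ∎
    where
    open ≡-Reasoning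
    oddCount : countᵇ odd (interval (suc a) (suc (m + m))) ≡ m
    oddCount = cong₂ _+_ (cong (fromBool ∘ not) (trans (evenᵇ-suc a) (cong not odd-a)))
                         (countᵇ-interval-double odd odd-alternates (suc (suc a)) m)

  violations≡desE : ∀ σ → violations σ ≡ desE σ
  violations≡desE [] = refl
  violations≡desE (x ∷ []) = refl
  violations≡desE (x ∷ y ∷ ys) = cong (fromBool (B₀ x y) +_) (violations≡desE (y ∷ ys))

  R-zero : ∀ n → R 0 (n + n) ≡ n ! * n !
  R-zero n = trans (R≡length-arrangements (interval-chain 1 (n + n)) oneTo↭ admissible⇔)
                   (length-arrangements-interval-double n 1 refl)
    where
    oneTo↭ : interval 1 (n + n) ↭ applyUpTo suc (n + n)
    oneTo↭ = ↭-reflexive (sym (applyUpTo≡interval suc 1 (n + n) (λ _ → refl)))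
    admissible⇔ : ∀ {σ} → σ ↭ applyUpTo suc (n + n) → Admissible σ ⇔ desE σ ≡ 0
    admissible⇔ {σ} _ =
      subst (λ d → Admissible σ ⇔ d ≡ 0) (violations≡desE σ) (Admissible⇔violations≡0 σ)

module EvensAreDescentTops where

  Bₙ : ℕ → ℕ → Bool
  Bₙ x y = evenᵇ x ∧ not (y <ᵇ x)

  open Arrangements Bₙ evenᵇ

  Bₙ-odd : ∀ {p} → evenᵇ p ≡ false → ∀ y → Bₙ p y ≡ false
  Bₙ-odd {p} odd-p y = cong (_∧ not (y <ᵇ p)) odd-p

  Bₙ-below : ∀ {p v} → p ≤ v → Bₙ p v ≡ evenᵇ p
  Bₙ-below {p} p≤v = trans (cong (λ b → evenᵇ p ∧ not b) (≤⇒<ᵇ≡false p≤v)) (∧-identityʳ _)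

  downFrom-chain : ∀ k → InsertionChain (applyDownFrom suc k)
  downFrom-chain zero = tt
  downFrom-chain (suc k) = insertable , downFrom-chain k
    where
    below : ∀ {z} → z ∈ applyDownFrom suc k → z ≤ k
    below = ∈-downFrom⁻ k
    insertable : Insertable (suc k) (applyDownFrom suc k)
    insertable = record
      { fresh        = λ k+1∈ → <-irrefl refl (below k+1∈)
      ; precedes-all = λ y∈ →
          trans (cong (λ b → evenᵇ (suc k) ∧ not b) (<⇒<ᵇ≡true (s≤s (below y∈)))) (∧-zeroʳ _)
      ; removable    = λ {p} p∈ p≺v →
          let odd-p = trans (sym (Bₙ-below (m≤n⇒m≤1+n (below p∈)))) p≺v in Bₙ-odd {p} odd-p , odd-p
      ; endable      = λ _ {p} _ odd-p → Bₙ-odd {p} odd-p (suc k)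
      }

  length-arrangements-downFrom : ∀ k → length (arrangements (applyDownFrom suc (suc k))) ≡
    countᵇ odd (applyDownFrom suc (suc k)) * length (arrangements (applyDownFrom suc k))
  length-arrangements-downFrom k =
    trans (length-arrangements (suc k) _ (downFrom-chain (suc k)))
          (cong (_* length (arrangements (applyDownFrom suc k))) slots≡)
    where
    slots≡ : slots (suc k) (applyDownFrom suc k) ≡ countᵇ odd (applyDownFrom suc (suc k))
    slots≡ = trans (cong (λ c → suc c ∸ fromBool (evenᵇ (suc k)))
                         (countᵇ-cong (λ p∈ → cong not (Bₙ-below (m≤n⇒m≤1+n (∈-downFrom⁻ k p∈))))))
                   (suc∸fromBool (evenᵇ (suc k)) _)

  length-arrangements-downFrom-double : ∀ m → length (arrangements (applyDownFrom suc (m + m))) ≡ m ! * m !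
  length-arrangements-downFrom-double zero = refl
  length-arrangements-downFrom-double (suc m) rewrite +-suc m m = begin
    length (arrangements (applyDownFrom suc (suc (suc (m + m)))))
      ≡⟨ length-arrangements-downFrom (suc (m + m)) ⟩
    countᵇ odd (applyDownFrom suc (suc (suc (m + m)))) * length (arrangements (applyDownFrom suc (suc (m + m))))
      ≡⟨ cong₂ _*_ oddCount₂ (length-arrangements-downFrom (m + m)) ⟩
    suc m * (countᵇ odd (applyDownFrom suc (suc (m + m))) * length (arrangements (applyDownFrom suc (m + m))))
      ≡⟨ cong₂ (λ c l → suc m * (c * l)) oddCount₁ (length-arrangements-downFrom-double m) ⟩
    suc m * (suc m * (m ! * m !))
      ≡⟨ square-interchange (suc m) (m !) ⟩
    suc m ! * suc m ! ∎
    where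
    open ≡-Reasoning
    oddCount₁ : countᵇ odd (applyDownFrom suc (suc (m + m))) ≡ suc m
    oddCount₁ = cong₂ _+_ (cong (fromBool ∘ not) (trans (evenᵇ-suc (m + m)) (cong not (evenᵇ-double m))))
                          (countᵇ-↭oneTo-double odd odd-alternates m (applyDownFrom↭applyUpTo suc (m + m)))
    oddCount₂ : countᵇ odd (applyDownFrom suc (suc (suc (m + m)))) ≡ suc m
    oddCount₂ = cong₂ _+_ (cong (fromBool ∘ not) (evenᵇ-double m)) oddCount₁

  -- Every even letter is either a descent top or a violation (followed by a larger letter, or last).
  desE+violations : ∀ σ → desE σ + violations σ ≡ countᵇ evenᵇ σ
  desE+violations [] = refl
  desE+violations (x ∷ []) = sym (+-identityʳ _)
  desE+violations (x ∷ y ∷ ys) = begin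
    (fromBool ((y <ᵇ x) ∧ evenᵇ x) + desE (y ∷ ys)) + (fromBool (Bₙ x y) + violations (y ∷ ys))
      ≡⟨ CommSemigroup.interchange +-commutativeSemigroup (fromBool ((y <ᵇ x) ∧ evenᵇ x)) _ _ _ ⟩
    (fromBool ((y <ᵇ x) ∧ evenᵇ x) + fromBool (Bₙ x y)) + (desE (y ∷ ys) + violations (y ∷ ys))
      ≡⟨ cong₂ _+_ (fromBool-∧-split (y <ᵇ x) (evenᵇ x)) (desE+violations (y ∷ ys)) ⟩
    fromBool (evenᵇ x) + countᵇ evenᵇ (y ∷ ys) ∎
    where open ≡-Reasoning

  admissible⇔ : ∀ n {σ} → σ ↭ applyUpTo suc (n + n) → Admissible σ ⇔ desE σ ≡ n
  admissible⇔ n {σ} σ↭ = mk⇔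
    (λ adm → trans (sym (trans (cong (desE σ +_) (Equivalence.to (Admissible⇔violations≡0 σ) adm))
                               (+-identityʳ _)))
                   total)
    (λ d → Equivalence.from (Admissible⇔violations≡0 σ)
             (+-cancelˡ-≡ n _ _ (trans (trans (cong (_+ violations σ) (sym d)) total) (sym (+-identityʳ n)))))
    where
    total : desE σ + violations σ ≡ n
    total = trans (desE+violations σ) (countᵇ-↭oneTo-double evenᵇ evenᵇ-suc n σ↭)

  R-max : ∀ n → R n (n + n) ≡ n ! * n !
  R-max n = trans (R≡length-arrangements (downFrom-chain (n + n)) (applyDownFrom↭applyUpTo suc (n + n))
                                         (admissible⇔ n))
                  (length-arrangements-downFrom-double n)

theorem3p3 : ∀ (n : ℕ) → 1 ≤ n →
    (R 0 (2 * n) ≡ (n !) * (n !)) × (R n (2 * n) ≡ (n !) * (n !))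
theorem3p3 n _ = subst (λ m → R 0 m ≡ n ! * n ! × R n m ≡ n ! * n !) (sym 2*n≡n+n)
  (EvenDescentFree.R-zero n , EvensAreDescentTops.R-max n)
  where
  2*n≡n+n : 2 * n ≡ n + n
  2*n≡n+n = cong (n +_) (+-identityʳ n)
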